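{- Suppose $\mathcal{U}=\{m_0h+a_0 : h=0,1,2,\dots\}\cup W$, where $m_0,a_0$ are positive integers and $W$ has asymptotic density zero. Let $a,m$ be positive integers with $\{mh+a : h=0,1,2,\dots\}\subseteq\mathcal{U}$. Then $m_0\mid m$ and $m_0\mid a-a_0$.
   Context: $\mathcal{U}$ denotes the set of positive odd integers $n$ that cannot be written as $n=p+2^k$ with $p$ a prime and $k$ a positive integer. A set $A$ of positive integers has asymptotic density $\delta$ if $|A\cap[1,x]|/x\to\delta$ as $x\to\infty$. -}

module Defs where

open import Data.Nat using (ℕ; _+_; _*_; _^_; _≤_; _≥_)
open import Data.Nat.Primality using (Prime)
open import Data.Product using (Σ; ∃; _×_)
open import Data.Sum using (_⊎_)
open import Data.List using (List; length)
open import Data.List.Relation.Unary.All using (All)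
open import Data.List.Relation.Unary.Unique.Propositional using (Unique)
open import Relation.Binary.PropositionalEquality using (_≡_)
open import Relation.Nullary using (¬_)

OddPos : ℕ → Set
OddPos n = ∃ λ j → n ≡ 2 * j + 1

PrimePlusPow2 : ℕ → Set
PrimePlusPow2 n = ∃ λ p → ∃ λ k → Prime p × 1 ≤ k × n ≡ p + 2 ^ k

U : ℕ → Set
U n = OddPos n × ¬ PrimePlusPow2 n

InAP : ℕ → ℕ → ℕ → Set
InAP m a n = ∃ λ h → n ≡ m * h + a

-- Asymptotic density zero of a set W of positive integers:
-- for every k ≥ 1 there is X such that for all x ≥ X, |W ∩ [1,x]| ≤ x / k,
-- where |W ∩ [1,x]| ≤ c is expressed as: every duplicate-free list of
-- elements of W ∩ [1,x] has length ≤ c (no decidability of W needed).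
DensityZero : (ℕ → Set) → Set
DensityZero W =
  ∀ k → 1 ≤ k → ∃ λ X → ∀ x → x ≥ X → ∀ (l : List ℕ) → Unique l →
    All (λ n → 1 ≤ n × n ≤ x × W n) l → k * length l ≤ x

{-# OPTIONS --safe #-}
-- If some term c of the progression m ℕ + a were not ≡ a₀ (mod m₀), then the whole
-- subprogression c + t m₀ m would lie in 𝒰 but avoid m₀ ℕ + a₀, hence lie in W;
-- a progression with positive difference d has density 1/d, contradicting density
-- zero. So every term is ≡ a₀ (mod m₀); comparing the terms a and a + m gives m₀ ∣ m.
module Submission where

open import Defs
open import Data.Nat using (ℕ; _≤_)
open import Data.Nat.Divisibility using (_∣_)
open import Data.Integer using (+_; _-_)
open import Data.Integer.Divisibility using () renaming (_∣_ to _∣ℤ_)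
open import Data.Product using (_×_)
open import Data.Sum using (_⊎_)
open import Function.Bundles using (_⇔_)

open import Data.Nat using (suc; _+_; _*_; _<_; s≤s; z≤n; >-nonZero)
open import Data.Nat.Properties
open import Data.Nat.Divisibility using (∣n⇒∣m*n; m∣m*n)
import Data.Integer as ℤ
import Data.Integer.Properties as ℤ
open import Data.Integer.Divisibility.Signed
  using (∣ᵤ⇒∣; ∣⇒∣ᵤ; _∣?_; ∣m+n∣n⇒∣m; ∣m+n∣m⇒∣n)
  renaming (_∣_ to _∣ˢ_)
open import Data.Integer.Solver using (module +-*-Solver)
open import Data.Product using (_,_)
open import Data.Sum using (inj₁; inj₂)
open import Data.List using (applyDownFrom; length)
open import Data.List.Properties using (length-applyDownFrom)
import Data.List.Relation.Unary.All.Properties as All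
import Data.List.Relation.Unary.Unique.Propositional.Properties as Unique
open import Function.Bundles using (Equivalence)
open import Relation.Binary.PropositionalEquality
open import Relation.Nullary using (¬_; yes; no; contradiction)

densityZero⇒¬⊇progression : (W : ℕ → Set) → DensityZero W →
  ∀ c d → 1 ≤ c → 1 ≤ d → ¬ (∀ t → W (c + t * d))
densityZero⇒¬⊇progression W density0 c d 1≤c 1≤d progression⊆W
  with density0 (suc d) (s≤s z≤n)
... | X , count≤ = <⇒≱ c<T T≤c
  where
  instance _ = >-nonZero 1≤d

  term : ℕ → ℕ
  term t = c + t * d

  term-< : ∀ {i j} → i < j → term i < term j
  term-< i<j = +-monoʳ-< c (*-monoˡ-< d i<j)

  -- The T terms below term T give (d + 1) T ≤ c + T d, i.e. T ≤ c; so take T > c.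
  T : ℕ
  T = X + suc c

  c<T : c < T
  c<T = m≤n+m (suc c) X

  X≤termT : X ≤ term T
  X≤termT = ≤-trans (m≤m+n X (suc c)) (≤-trans (m≤m*n T d) (m≤n+m (T * d) c))

  count : suc d * length (applyDownFrom term T) ≤ term T
  count = count≤ (term T) X≤termT (applyDownFrom term T)
    (Unique.applyDownFrom⁺₁ term T (λ j<i _ → >⇒≢ (term-< j<i)))
    (All.applyDownFrom⁺₁ term T (λ {t} t<T →
      ≤-trans 1≤c (m≤m+n c (t * d)) , <⇒≤ (term-< t<T) , progression⊆W t))

  T≤c : T ≤ c
  T≤c = +-cancelʳ-≤ (T * d) T c (begin
    T + T * d                             ≡⟨ cong (_+_ T) (*-comm T d) ⟩
    suc d * T                             ≡⟨ cong (suc d *_) (length-applyDownFrom term T) ⟨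
    suc d * length (applyDownFrom term T) ≤⟨ count ⟩
    c + T * d                             ∎)
    where open ≤-Reasoning

+[m+n]-o≡[+m-o]++n : ∀ m n o → + (m + n) - + o ≡ (+ m - + o) ℤ.+ + n
+[m+n]-o≡[+m-o]++n m n o = begin
  + (m + n) - + o         ≡⟨ cong (_- + o) (ℤ.pos-+ m n) ⟩
  (+ m ℤ.+ + n) - + o     ≡⟨ solve 3 (λ x y z → x :+ y :- z := (x :- z) :+ y) refl (+ m) (+ n) (+ o) ⟩
  (+ m - + o) ℤ.+ + n     ∎
  where
  open ≡-Reasoning
  open +-*-Solver

inAP⇒∣- : ∀ {m a n} → InAP m a n → + m ∣ˢ + n - + a
inAP⇒∣- {m} {a} (h , refl) rewrite +-comm (m * h) a | +[m+n]-o≡[+m-o]++n a (m * h) a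
                                 | ℤ.+-inverseʳ (+ a) =
  ∣ᵤ⇒∣ (m∣m*n h)

inAP-+* : ∀ {m a n} k → InAP m a n → InAP m a (n + k * m)
inAP-+* {m} {a} k (h , refl) = h + k , (begin
  m * h + a + k * m   ≡⟨ +-assoc (m * h) a (k * m) ⟩
  m * h + (a + k * m) ≡⟨ cong (_+_ (m * h)) (+-comm a (k * m)) ⟩
  m * h + (k * m + a) ≡⟨ +-assoc (m * h) (k * m) a ⟨
  m * h + k * m + a   ≡⟨ cong (λ x → m * h + x + a) (*-comm k m) ⟩
  m * h + m * k + a   ≡⟨ cong (_+ a) (*-distribˡ-+ m h k) ⟨
  m * (h + k) + a     ∎)
  where open ≡-Reasoning

module _ {m₀ a₀ : ℕ} (1≤m₀ : 1 ≤ m₀) {W : ℕ → Set}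
         (U⇔ : ∀ n → U n ⇔ (InAP m₀ a₀ n ⊎ W n)) (density0 : DensityZero W)
         {m a : ℕ} (1≤m : 1 ≤ m) (AP⊆U : ∀ n → InAP m a n → U n) where

  inAP⊆U⇒∣- : ∀ {c} → 1 ≤ c → InAP m a c → + m₀ ∣ˢ + c - + a₀
  inAP⊆U⇒∣- {c} 1≤c c∈AP with + m₀ ∣? (+ c - + a₀)
  ... | yes m₀∣c-a₀ = m₀∣c-a₀
  ... | no  m₀∤c-a₀ =
    contradiction progression⊆W
      (densityZero⇒¬⊇progression W density0 c (m₀ * m) 1≤c (*-mono-≤ 1≤m₀ 1≤m))
    where
    progression⊆W : ∀ t → W (c + t * (m₀ * m))
    progression⊆W t with Equivalence.to (U⇔ _) (AP⊆U _ term∈AP)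
      where
      term∈AP : InAP m a (c + t * (m₀ * m))
      term∈AP = subst (InAP m a) (cong (_+_ c) (*-assoc t m₀ m)) (inAP-+* (t * m₀) c∈AP)
    ... | inj₂ term∈W = term∈W
    ... | inj₁ term∈AP₀ = contradiction
      (∣m+n∣n⇒∣m (subst (+ m₀ ∣ˢ_) (+[m+n]-o≡[+m-o]++n c (t * (m₀ * m)) a₀) (inAP⇒∣- term∈AP₀))
                 (∣ᵤ⇒∣ (∣n⇒∣m*n t (m∣m*n m))))
      m₀∤c-a₀

lemma1 : (m₀ a₀ : ℕ) → 1 ≤ m₀ → 1 ≤ a₀ → (W : ℕ → Set) →
    (∀ n → U n ⇔ (InAP m₀ a₀ n ⊎ W n)) → DensityZero W →
    (a m : ℕ) → 1 ≤ a → 1 ≤ m → (∀ n → InAP m a n → U n) →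
    (m₀ ∣ m) × ((+ m₀) ∣ℤ ((+ a) - (+ a₀)))
lemma1 m₀ a₀ 1≤m₀ _ W U⇔ density0 a m 1≤a 1≤m AP⊆U = ∣⇒∣ᵤ m₀∣m , ∣⇒∣ᵤ m₀∣a-a₀
  where
  ≡a₀-mod-m₀ : ∀ {c} → 1 ≤ c → InAP m a c → + m₀ ∣ˢ + c - + a₀
  ≡a₀-mod-m₀ = inAP⊆U⇒∣- 1≤m₀ U⇔ density0 1≤m AP⊆U

  m₀∣a-a₀ : + m₀ ∣ˢ + a - + a₀
  m₀∣a-a₀ = ≡a₀-mod-m₀ 1≤a (0 , cong (_+ a) (sym (*-zeroʳ m)))

  m₀∣a+m-a₀ : + m₀ ∣ˢ + (a + m) - + a₀
  m₀∣a+m-a₀ = ≡a₀-mod-m₀ (≤-trans 1≤a (m≤m+n a m))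
    (1 , trans (+-comm a m) (cong (_+ a) (sym (*-identityʳ m))))

  m₀∣m : + m₀ ∣ˢ + m
  m₀∣m = ∣m+n∣m⇒∣n (subst (+ m₀ ∣ˢ_) (+[m+n]-o≡[+m-o]++n a m a₀) m₀∣a+m-a₀) m₀∣a-a₀
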